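{- The polynomial $p(x) = x^{10} - x^8 - x^5 + x + 1$, whose Mahler measure is approximately $1.419404632$, divides no Newman polynomial; that is, there is no Newman polynomial $F$ and no $q \in \mathbb{Z}[x]$ with $F = p\,q$.
   Context: For a polynomial $p(x) = b_0\prod_{k=1}^d (x-\alpha_k) \in \mathbb{C}[x]$ with $b_0 \neq 0$, its Mahler measure is $M(p) = |b_0|\prod_{k=1}^d \max(1,|\alpha_k|)$. A Newman polynomial is a polynomial all of whose coefficients lie in $\{0,1\}$ and whose constant term is $1$. -}

module Defs where

open import Data.Nat using (ℕ; zero; suc)
open import Data.Integer using (ℤ; +_; -[1+_]; _+_; _*_)
open import Data.List using (List; []; _∷_; map)
open import Data.Product using (_×_)
open import Data.Sum using (_⊎_)
open import Relation.Binary.PropositionalEquality using (_≡_)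

-- A polynomial in ℤ[x] is represented by its list of coefficients,
-- lowest degree first: a₀ ∷ a₁ ∷ … represents a₀ + a₁ x + ….
-- Trailing zeros are allowed; polynomials are compared coefficientwise.
Poly : Set
Poly = List ℤ

coeff : Poly → ℕ → ℤ
coeff []       _       = + 0
coeff (a ∷ _)  zero    = a
coeff (_ ∷ as) (suc n) = coeff as n

_⊕_ : Poly → Poly → Poly
[]       ⊕ q        = q
(a ∷ p)  ⊕ []       = a ∷ p
(a ∷ p)  ⊕ (b ∷ q)  = (a + b) ∷ (p ⊕ q)

_⊗_ : Poly → Poly → Poly
[]      ⊗ q = []
(a ∷ p) ⊗ q = map (a *_) q ⊕ (+ 0 ∷ (p ⊗ q))

_≈ₚ_ : Poly → Poly → Set
f ≈ₚ g = ∀ n → coeff f n ≡ coeff g n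

IsNewman : Poly → Set
IsNewman f = (∀ n → coeff f n ≡ + 0 ⊎ coeff f n ≡ + 1) × coeff f 0 ≡ + 1

p₀ : Poly
p₀ = + 1 ∷ + 1 ∷ + 0 ∷ + 0 ∷ + 0 ∷ -[1+ 0 ] ∷ + 0 ∷ + 0 ∷ -[1+ 0 ] ∷ + 0 ∷ + 1 ∷ []

{-# OPTIONS --safe #-}
module Submission where

open import Defs
open import Data.Nat as ℕ using (ℕ; zero; suc; z≤n; s≤s; _⊔_; _∸_)
import Data.Nat.Properties as ℕP
open import Data.Integer as ℤ using (ℤ; +_; -[1+_]; _+_; _*_; _-_; -_; _⊓_; ∣_∣; +≤+; -≤+)
import Data.Integer.Properties as ℤP
open import Data.List using ([]; _∷_; map; drop)
open import Data.Product using (Σ; ∃-syntax; _×_; _,_; proj₁; proj₂)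
open import Data.Sum using (_⊎_; inj₁; inj₂)
open import Data.Unit using (tt)
open import Data.Empty using (⊥-elim)
open import Function using (_∘_)
open import Relation.Nullary using (¬_; yes; no)
open import Relation.Binary.PropositionalEquality
  using (_≡_; _≢_; refl; sym; trans; cong; cong₂; subst; module ≡-Reasoning)
open import Algebra.Properties.CommutativeSemigroup ℤP.+-commutativeSemigroup
  using (x∙yz≈y∙xz; interchange)

-- Suppose F = p₀ q is a Newman polynomial.  The proof multiplies F by two integer
-- polynomials, G₁ and g₂ + x G₂, found by computer.
--
-- In G₁ p₀ the coefficient of x¹²⁰ is 10001, and all other coefficients together have
-- ℓ¹-norm 441.  Comparing coefficients of x^(120 + n) in G₁ F = (G₁ p₀) q, where n is
-- chosen with |q_n| = ‖q‖∞, gives 10001 ‖q‖∞ ≤ ‖G₁‖₁ + 441 ‖q‖∞ = 132894 + 441 ‖q‖∞,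
-- so ‖q‖∞ ≤ 13.
--
-- As p₀ is monic of degree 10, F has degree 10 + deg q and leading coefficient that of
-- q, which must then be 1.  Because F has 0/1 coefficients, the coefficient of
-- x^(deg F) in (g₂ + x G₂) F is at least g₂ plus the sum of the negative coefficients
-- of G₂, which is 3077.  But this coefficient only involves the coefficients of
-- (g₂ + x G₂) p₀ from x¹⁰ on, of ℓ¹-norm 34, so it is at most 34 · 13 = 442.

∣i∣≤∣i+j∣+∣j∣ : ∀ i j → ∣ i ∣ ℕ.≤ ∣ i + j ∣ ℕ.+ ∣ j ∣
∣i∣≤∣i+j∣+∣j∣ i j = subst (λ x → ∣ x ∣ ℕ.≤ ∣ i + j ∣ ℕ.+ ∣ j ∣) i+j-j≡i (ℤP.∣i-j∣≤∣i∣+∣j∣ (i + j) j)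
  where
  i+j-j≡i : i + j - j ≡ i
  i+j-j≡i = trans (ℤP.+-assoc i j (- j)) (trans (cong (_+_ i) (ℤP.+-inverseʳ j)) (ℤP.+-identityʳ i))

a*m≤c+b*m⇒[a∸b]*m≤c : ∀ a b c m → a ℕ.* m ℕ.≤ c ℕ.+ b ℕ.* m → (a ∸ b) ℕ.* m ℕ.≤ c
a*m≤c+b*m⇒[a∸b]*m≤c a b c m am≤c+bm = begin
  (a ∸ b) ℕ.* m               ≡⟨ ℕP.*-distribʳ-∸ m a b ⟩
  a ℕ.* m ∸ b ℕ.* m           ≤⟨ ℕP.∸-monoˡ-≤ (b ℕ.* m) am≤c+bm ⟩
  c ℕ.+ b ℕ.* m ∸ b ℕ.* m     ≡⟨ ℕP.m+n∸n≡m c (b ℕ.* m) ⟩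
  c                           ∎
  where open ℕP.≤-Reasoning

coeff-⊕ : ∀ P Q k → coeff (P ⊕ Q) k ≡ coeff P k + coeff Q k
coeff-⊕ []      Q       k       = sym (ℤP.+-identityˡ _)
coeff-⊕ (a ∷ P) []      k       = sym (ℤP.+-identityʳ _)
coeff-⊕ (a ∷ P) (b ∷ Q) zero    = refl
coeff-⊕ (a ∷ P) (b ∷ Q) (suc k) = coeff-⊕ P Q k

coeff-scale : ∀ a P k → coeff (map (a *_) P) k ≡ a * coeff P k
coeff-scale a []      k       = sym (ℤP.*-zeroʳ a)
coeff-scale a (b ∷ P) zero    = refl
coeff-scale a (b ∷ P) (suc k) = coeff-scale a P k

coeff-∷⊗ : ∀ a P Q k → coeff ((a ∷ P) ⊗ Q) k ≡ a * coeff Q k + coeff (+ 0 ∷ (P ⊗ Q)) k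
coeff-∷⊗ a P Q k =
  trans (coeff-⊕ (map (a *_) Q) _ k) (cong (_+ coeff (+ 0 ∷ (P ⊗ Q)) k) (coeff-scale a Q k))

coeff-0∷⊗ : ∀ P Q k → coeff ((+ 0 ∷ P) ⊗ Q) k ≡ coeff (+ 0 ∷ (P ⊗ Q)) k
coeff-0∷⊗ P Q k = trans (coeff-∷⊗ (+ 0) P Q k) (ℤP.+-identityˡ _)

coeff-[a]⊗ : ∀ a Q k → coeff ((a ∷ []) ⊗ Q) k ≡ a * coeff Q k
coeff-[a]⊗ a Q zero    = trans (coeff-∷⊗ a [] Q 0) (ℤP.+-identityʳ _)
coeff-[a]⊗ a Q (suc k) = trans (coeff-∷⊗ a [] Q (suc k)) (ℤP.+-identityʳ _)

0∷-cong : ∀ {P Q} → P ≈ₚ Q → (+ 0 ∷ P) ≈ₚ (+ 0 ∷ Q)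
0∷-cong P≈Q zero    = refl
0∷-cong P≈Q (suc k) = P≈Q k

⊗-congʳ : ∀ P Q Q′ → Q ≈ₚ Q′ → (P ⊗ Q) ≈ₚ (P ⊗ Q′)
⊗-congʳ []      Q Q′ Q≈Q′ k = refl
⊗-congʳ (a ∷ P) Q Q′ Q≈Q′ k = begin
  coeff ((a ∷ P) ⊗ Q) k                      ≡⟨ coeff-∷⊗ a P Q k ⟩
  a * coeff Q k + coeff (+ 0 ∷ (P ⊗ Q)) k    ≡⟨ cong₂ (λ x y → a * x + y) (Q≈Q′ k)
                                                      (0∷-cong (⊗-congʳ P Q Q′ Q≈Q′) k) ⟩
  a * coeff Q′ k + coeff (+ 0 ∷ (P ⊗ Q′)) k  ≡⟨ coeff-∷⊗ a P Q′ k ⟨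
  coeff ((a ∷ P) ⊗ Q′) k                     ∎
  where open ≡-Reasoning

coeff-⊕⊗ : ∀ P Q R k → coeff ((P ⊕ Q) ⊗ R) k ≡ coeff (P ⊗ R) k + coeff (Q ⊗ R) k
coeff-⊕⊗ []      Q       R k = sym (ℤP.+-identityˡ _)
coeff-⊕⊗ (a ∷ P) []      R k = sym (ℤP.+-identityʳ _)
coeff-⊕⊗ (a ∷ P) (b ∷ Q) R k = begin
  coeff (((a + b) ∷ (P ⊕ Q)) ⊗ R) k                  ≡⟨ coeff-∷⊗ (a + b) (P ⊕ Q) R k ⟩
  (a + b) * r + coeff (+ 0 ∷ ((P ⊕ Q) ⊗ R)) k         ≡⟨ cong₂ _+_ (ℤP.*-distribʳ-+ r a b) (shifted k) ⟩
  (a * r + b * r) + (s + t)                          ≡⟨ interchange (a * r) (b * r) s t ⟩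
  (a * r + s) + (b * r + t)                          ≡⟨ cong₂ _+_ (coeff-∷⊗ a P R k) (coeff-∷⊗ b Q R k) ⟨
  coeff ((a ∷ P) ⊗ R) k + coeff ((b ∷ Q) ⊗ R) k      ∎
  where
  open ≡-Reasoning
  r s t : ℤ
  r = coeff R k
  s = coeff (+ 0 ∷ (P ⊗ R)) k
  t = coeff (+ 0 ∷ (Q ⊗ R)) k
  shifted : ∀ k → coeff (+ 0 ∷ ((P ⊕ Q) ⊗ R)) k ≡ coeff (+ 0 ∷ (P ⊗ R)) k + coeff (+ 0 ∷ (Q ⊗ R)) k
  shifted zero    = refl
  shifted (suc k) = coeff-⊕⊗ P Q R k

coeff-scale⊗ : ∀ a P Q k → coeff (map (a *_) P ⊗ Q) k ≡ a * coeff (P ⊗ Q) k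
coeff-scale⊗ a []      Q k = sym (ℤP.*-zeroʳ a)
coeff-scale⊗ a (b ∷ P) Q k = begin
  coeff ((a * b ∷ map (a *_) P) ⊗ Q) k
    ≡⟨ coeff-∷⊗ (a * b) (map (a *_) P) Q k ⟩
  a * b * coeff Q k + coeff (+ 0 ∷ (map (a *_) P ⊗ Q)) k
    ≡⟨ cong₂ _+_ (ℤP.*-assoc a b _) (shifted k) ⟩
  a * (b * coeff Q k) + a * coeff (+ 0 ∷ (P ⊗ Q)) k
    ≡⟨ ℤP.*-distribˡ-+ a _ _ ⟨
  a * (b * coeff Q k + coeff (+ 0 ∷ (P ⊗ Q)) k)
    ≡⟨ cong (a *_) (coeff-∷⊗ b P Q k) ⟨
  a * coeff ((b ∷ P) ⊗ Q) k
    ∎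
  where
  open ≡-Reasoning
  shifted : ∀ k → coeff (+ 0 ∷ (map (a *_) P ⊗ Q)) k ≡ a * coeff (+ 0 ∷ (P ⊗ Q)) k
  shifted zero    = sym (ℤP.*-zeroʳ a)
  shifted (suc k) = coeff-scale⊗ a P Q k

⊗-assoc : ∀ P Q R → ((P ⊗ Q) ⊗ R) ≈ₚ (P ⊗ (Q ⊗ R))
⊗-assoc []      Q R k = refl
⊗-assoc (a ∷ P) Q R k = begin
  coeff ((map (a *_) Q ⊕ (+ 0 ∷ (P ⊗ Q))) ⊗ R) k
    ≡⟨ coeff-⊕⊗ (map (a *_) Q) _ R k ⟩
  coeff (map (a *_) Q ⊗ R) k + coeff ((+ 0 ∷ (P ⊗ Q)) ⊗ R) k
    ≡⟨ cong₂ _+_ (coeff-scale⊗ a Q R k) (coeff-0∷⊗ (P ⊗ Q) R k) ⟩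
  a * coeff (Q ⊗ R) k + coeff (+ 0 ∷ ((P ⊗ Q) ⊗ R)) k
    ≡⟨ cong (λ x → a * coeff (Q ⊗ R) k + x) (0∷-cong (⊗-assoc P Q R) k) ⟩
  a * coeff (Q ⊗ R) k + coeff (+ 0 ∷ (P ⊗ (Q ⊗ R))) k
    ≡⟨ coeff-∷⊗ a P (Q ⊗ R) k ⟨
  coeff ((a ∷ P) ⊗ (Q ⊗ R)) k
    ∎
  where open ≡-Reasoning

‖_‖₁ : Poly → ℕ
‖ []    ‖₁ = 0
‖ a ∷ P ‖₁ = ∣ a ∣ ℕ.+ ‖ P ‖₁

‖_‖∞ : Poly → ℕ
‖ []    ‖∞ = 0
‖ a ∷ P ‖∞ = ∣ a ∣ ⊔ ‖ P ‖∞

∣coeff∣≤‖‖∞ : ∀ P k → ∣ coeff P k ∣ ℕ.≤ ‖ P ‖∞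
∣coeff∣≤‖‖∞ []      k       = z≤n
∣coeff∣≤‖‖∞ (a ∷ P) zero    = ℕP.m≤m⊔n ∣ a ∣ ‖ P ‖∞
∣coeff∣≤‖‖∞ (a ∷ P) (suc k) = ℕP.m≤n⇒m≤o⊔n ∣ a ∣ (∣coeff∣≤‖‖∞ P k)

‖‖∞-attained : ∀ P → ∃[ k ] ‖ P ‖∞ ≡ ∣ coeff P k ∣
‖‖∞-attained []      = 0 , refl
‖‖∞-attained (a ∷ P) with ℕP.⊔-sel ∣ a ∣ ‖ P ‖∞
... | inj₁ ‖aP‖≡∣a∣ = 0 , ‖aP‖≡∣a∣
... | inj₂ ‖aP‖≡‖P‖ = let k , ‖P‖≡∣Pₖ∣ = ‖‖∞-attained P in suc k , trans ‖aP‖≡‖P‖ ‖P‖≡∣Pₖ∣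

∣coeff-⊗∣≤ : ∀ P Q M → (∀ k → ∣ coeff Q k ∣ ℕ.≤ M) → ∀ k → ∣ coeff (P ⊗ Q) k ∣ ℕ.≤ ‖ P ‖₁ ℕ.* M
∣coeff-⊗∣≤ []      Q M Q≤M k = z≤n
∣coeff-⊗∣≤ (a ∷ P) Q M Q≤M k = begin
  ∣ coeff ((a ∷ P) ⊗ Q) k ∣                              ≡⟨ cong ∣_∣ (coeff-∷⊗ a P Q k) ⟩
  ∣ a * coeff Q k + coeff (+ 0 ∷ (P ⊗ Q)) k ∣            ≤⟨ ℤP.∣i+j∣≤∣i∣+∣j∣ (a * coeff Q k) _ ⟩
  ∣ a * coeff Q k ∣ ℕ.+ ∣ coeff (+ 0 ∷ (P ⊗ Q)) k ∣      ≡⟨ cong (ℕ._+ _) (ℤP.abs-* a (coeff Q k)) ⟩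
  ∣ a ∣ ℕ.* ∣ coeff Q k ∣ ℕ.+ ∣ coeff (+ 0 ∷ (P ⊗ Q)) k ∣ ≤⟨ ℕP.+-mono-≤ (ℕP.*-monoʳ-≤ ∣ a ∣ (Q≤M k)) (shifted k) ⟩
  ∣ a ∣ ℕ.* M ℕ.+ ‖ P ‖₁ ℕ.* M                          ≡⟨ ℕP.*-distribʳ-+ M ∣ a ∣ ‖ P ‖₁ ⟨
  ‖ a ∷ P ‖₁ ℕ.* M                                      ∎
  where
  open ℕP.≤-Reasoning
  shifted : ∀ k → ∣ coeff (+ 0 ∷ (P ⊗ Q)) k ∣ ℕ.≤ ‖ P ‖₁ ℕ.* M
  shifted zero    = z≤n
  shifted (suc k) = ∣coeff-⊗∣≤ P Q M Q≤M k

IsBit : ℤ → Set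
IsBit a = a ≡ + 0 ⊎ a ≡ + 1

∣bit∣≤1 : ∀ {a} → IsBit a → ∣ a ∣ ℕ.≤ 1
∣bit∣≤1 (inj₁ refl) = z≤n
∣bit∣≤1 (inj₂ refl) = s≤s z≤n

negativeSum : Poly → ℤ
negativeSum []      = + 0
negativeSum (a ∷ P) = a ⊓ + 0 + negativeSum P

negativeSum≤0 : ∀ P → negativeSum P ℤ.≤ + 0
negativeSum≤0 []      = ℤP.≤-refl
negativeSum≤0 (a ∷ P) = ℤP.+-mono-≤ (ℤP.i⊓j≤j a (+ 0)) (negativeSum≤0 P)

a⊓0≤a*bit : ∀ a {b} → IsBit b → a ⊓ + 0 ℤ.≤ a * b
a⊓0≤a*bit a (inj₁ refl) = subst (a ⊓ + 0 ℤ.≤_) (sym (ℤP.*-zeroʳ a)) (ℤP.i⊓j≤j a (+ 0))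
a⊓0≤a*bit a (inj₂ refl) = subst (a ⊓ + 0 ℤ.≤_) (sym (ℤP.*-identityʳ a)) (ℤP.i⊓j≤i a (+ 0))

negativeSum≤coeff-⊗ : ∀ P F → (∀ n → IsBit (coeff F n)) → ∀ k → negativeSum P ℤ.≤ coeff (P ⊗ F) k
negativeSum≤coeff-⊗ []      F F01 k = ℤP.≤-refl
negativeSum≤coeff-⊗ (a ∷ P) F F01 k =
  subst (negativeSum (a ∷ P) ℤ.≤_) (sym (coeff-∷⊗ a P F k))
        (ℤP.+-mono-≤ (a⊓0≤a*bit a (F01 k)) (shifted k))
  where
  shifted : ∀ k → negativeSum P ℤ.≤ coeff (+ 0 ∷ (P ⊗ F)) k
  shifted zero    = negativeSum≤0 P
  shifted (suc k) = negativeSum≤coeff-⊗ P F F01 k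

g+negativeSum≤coeff-⊗ : ∀ g P F → (∀ n → IsBit (coeff F n)) → ∀ k → coeff F (suc k) ≡ + 1 →
                        g + negativeSum P ℤ.≤ coeff ((g ∷ P) ⊗ F) (suc k)
g+negativeSum≤coeff-⊗ g P F F01 k Fₖ₊₁≡1 =
  subst (g + negativeSum P ℤ.≤_) (sym (coeff-∷⊗ g P F (suc k)))
        (ℤP.+-mono-≤ (ℤP.≤-reflexive g≡g*Fₖ₊₁) (negativeSum≤coeff-⊗ P F F01 k))
  where
  g≡g*Fₖ₊₁ : g ≡ g * coeff F (suc k)
  g≡g*Fₖ₊₁ = sym (trans (cong (g *_) Fₖ₊₁≡1) (ℤP.*-identityʳ g))

clearCoeff : ℕ → Poly → Poly
clearCoeff _       []      = []
clearCoeff zero    (a ∷ P) = + 0 ∷ P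
clearCoeff (suc k) (a ∷ P) = a ∷ clearCoeff k P

coeff-⊗-isolate : ∀ P Q k n →
  coeff (P ⊗ Q) (k ℕ.+ n) ≡ coeff P k * coeff Q n + coeff (clearCoeff k P ⊗ Q) (k ℕ.+ n)
coeff-⊗-isolate []      Q k       n = sym (ℤP.+-identityʳ (+ 0 * coeff Q n))
coeff-⊗-isolate (a ∷ P) Q zero    n =
  trans (coeff-∷⊗ a P Q n) (cong (_+_ (a * coeff Q n)) (sym (coeff-0∷⊗ P Q n)))
coeff-⊗-isolate (a ∷ P) Q (suc k) n = begin
  coeff ((a ∷ P) ⊗ Q) (suc m)
    ≡⟨ coeff-∷⊗ a P Q (suc m) ⟩
  a * coeff Q (suc m) + coeff (P ⊗ Q) m
    ≡⟨ cong (_+_ (a * coeff Q (suc m))) (coeff-⊗-isolate P Q k n) ⟩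
  a * coeff Q (suc m) + (x + coeff (clearCoeff k P ⊗ Q) m)
    ≡⟨ x∙yz≈y∙xz (a * coeff Q (suc m)) x _ ⟩
  x + (a * coeff Q (suc m) + coeff (clearCoeff k P ⊗ Q) m)
    ≡⟨ cong (_+_ x) (coeff-∷⊗ a (clearCoeff k P) Q (suc m)) ⟨
  x + coeff ((a ∷ clearCoeff k P) ⊗ Q) (suc m)
    ∎
  where
  open ≡-Reasoning
  m : ℕ
  m = k ℕ.+ n
  x : ℤ
  x = coeff P k * coeff Q n

VanishesAbove : ℕ → Poly → Set
VanishesAbove d Q = ∀ n → d ℕ.< n → coeff Q n ≡ + 0

HasDegree : Poly → ℕ → Set
HasDegree Q d = coeff Q d ≢ + 0 × VanishesAbove d Q

coeff-⊗-drop : ∀ P Q k d → VanishesAbove d Q → coeff (P ⊗ Q) (k ℕ.+ d) ≡ coeff (drop k P ⊗ Q) d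
coeff-⊗-drop P       Q zero    d Q>d≡0 = refl
coeff-⊗-drop []      Q (suc k) d Q>d≡0 = refl
coeff-⊗-drop (a ∷ P) Q (suc k) d Q>d≡0 = begin
  coeff ((a ∷ P) ⊗ Q) (suc (k ℕ.+ d))                  ≡⟨ coeff-∷⊗ a P Q (suc (k ℕ.+ d)) ⟩
  a * coeff Q (suc (k ℕ.+ d)) + coeff (P ⊗ Q) (k ℕ.+ d) ≡⟨ cong (λ x → a * x + coeff (P ⊗ Q) (k ℕ.+ d))
                                                               (Q>d≡0 _ (s≤s (ℕP.m≤n+m d k))) ⟩
  a * + 0 + coeff (P ⊗ Q) (k ℕ.+ d)                    ≡⟨ cong (_+ coeff (P ⊗ Q) (k ℕ.+ d)) (ℤP.*-zeroʳ a) ⟩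
  + 0 + coeff (P ⊗ Q) (k ℕ.+ d)                        ≡⟨ ℤP.+-identityˡ _ ⟩
  coeff (P ⊗ Q) (k ℕ.+ d)                              ≡⟨ coeff-⊗-drop P Q k d Q>d≡0 ⟩
  coeff (drop k P ⊗ Q) d                               ∎
  where open ≡-Reasoning

zero⊎degree : ∀ Q → (∀ n → coeff Q n ≡ + 0) ⊎ ∃[ d ] HasDegree Q d
zero⊎degree []      = inj₁ (λ _ → refl)
zero⊎degree (a ∷ Q) with zero⊎degree Q
... | inj₂ (d , Q_d≢0 , Q>d≡0) = inj₂ (suc d , Q_d≢0 , λ { (suc n) (s≤s d<n) → Q>d≡0 n d<n })
... | inj₁ Q≡0 with a ℤ.≟ + 0
...   | yes refl = inj₁ λ { zero → refl ; (suc n) → Q≡0 n }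
...   | no  a≢0  = inj₂ (0 , a≢0 , λ { (suc n) _ → Q≡0 n })

module _ (p q F : Poly) (F≈pq : F ≈ₚ (p ⊗ q)) where

  ⊗-factor : ∀ G → (G ⊗ F) ≈ₚ ((G ⊗ p) ⊗ q)
  ⊗-factor G k = trans (⊗-congʳ G F (p ⊗ q) F≈pq k) (sym (⊗-assoc G p q k))

  dominant-coeff-bound : ∀ {B} → (∀ n → ∣ coeff F n ∣ ℕ.≤ B) → ∀ G k →
    (∣ coeff (G ⊗ p) k ∣ ∸ ‖ clearCoeff k (G ⊗ p) ‖₁) ℕ.* ‖ q ‖∞ ℕ.≤ ‖ G ‖₁ ℕ.* B
  dominant-coeff-bound {B} F≤B G k = a*m≤c+b*m⇒[a∸b]*m≤c ∣ h ∣ ‖ R ‖₁ (‖ G ‖₁ ℕ.* B) ‖ q ‖∞ (begin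
    ∣ h ∣ ℕ.* ‖ q ‖∞                                 ≡⟨ cong (∣ h ∣ ℕ.*_) ‖q‖≡∣qₙ∣ ⟩
    ∣ h ∣ ℕ.* ∣ coeff q n ∣                          ≡⟨ ℤP.abs-* h (coeff q n) ⟨
    ∣ h * coeff q n ∣                                ≤⟨ ∣i∣≤∣i+j∣+∣j∣ (h * coeff q n) r ⟩
    ∣ h * coeff q n + r ∣ ℕ.+ ∣ r ∣                  ≡⟨ cong (λ x → ∣ x ∣ ℕ.+ ∣ r ∣) isolate ⟨
    ∣ coeff (G ⊗ F) (k ℕ.+ n) ∣ ℕ.+ ∣ r ∣            ≤⟨ ℕP.+-mono-≤ (∣coeff-⊗∣≤ G F B F≤B (k ℕ.+ n))
                                                        (∣coeff-⊗∣≤ R q ‖ q ‖∞ (∣coeff∣≤‖‖∞ q) (k ℕ.+ n)) ⟩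
    ‖ G ‖₁ ℕ.* B ℕ.+ ‖ R ‖₁ ℕ.* ‖ q ‖∞               ∎)
    where
    open ℕP.≤-Reasoning
    n : ℕ
    n = proj₁ (‖‖∞-attained q)
    ‖q‖≡∣qₙ∣ : ‖ q ‖∞ ≡ ∣ coeff q n ∣
    ‖q‖≡∣qₙ∣ = proj₂ (‖‖∞-attained q)
    h : ℤ
    h = coeff (G ⊗ p) k
    R : Poly
    R = clearCoeff k (G ⊗ p)
    r : ℤ
    r = coeff (R ⊗ q) (k ℕ.+ n)
    isolate : coeff (G ⊗ F) (k ℕ.+ n) ≡ h * coeff q n + r
    isolate = trans (⊗-factor G (k ℕ.+ n)) (coeff-⊗-isolate (G ⊗ p) q k n)

  coeff-⊗-top : ∀ {d} → VanishesAbove d q → ∀ G k → coeff (G ⊗ F) (k ℕ.+ d) ≡ coeff (drop k (G ⊗ p) ⊗ q) d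
  coeff-⊗-top {d} q>d≡0 G k = trans (⊗-factor G (k ℕ.+ d)) (coeff-⊗-drop (G ⊗ p) q k d q>d≡0)

-- Opaque, so that unification never unfolds these long literals.
opaque
  G₁ : Poly
  G₁ =
    + 68 ∷ -[1+ 86 ] ∷ + 95 ∷ -[1+ 92 ] ∷ + 80 ∷ -[1+ 54 ] ∷ + 21 ∷ + 18 ∷ -[1+ 54 ] ∷ + 89 ∷ -[1+ 115 ] ∷ + 131 ∷
    -[1+ 128 ] ∷ + 112 ∷ -[1+ 82 ] ∷ + 39 ∷ + 17 ∷ -[1+ 74 ] ∷ + 125 ∷ -[1+ 165 ] ∷ + 192 ∷ -[1+ 193 ] ∷ + 166 ∷ -[1+ 113 ] ∷
    + 47 ∷ + 31 ∷ -[1+ 115 ] ∷ + 191 ∷ -[1+ 237 ] ∷ + 257 ∷ -[1+ 252 ] ∷ + 216 ∷ -[1+ 142 ] ∷ + 50 ∷ + 43 ∷ -[1+ 135 ] ∷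
    + 230 ∷ -[1+ 306 ] ∷ + 343 ∷ -[1+ 341 ] ∷ + 315 ∷ -[1+ 249 ] ∷ + 129 ∷ + 28 ∷ -[1+ 181 ] ∷ + 325 ∷ -[1+ 462 ] ∷ + 558 ∷
    -[1+ 557 ] ∷ + 467 ∷ -[1+ 327 ] ∷ + 144 ∷ + 103 ∷ -[1+ 363 ] ∷ + 550 ∷ -[1+ 645 ] ∷ + 694 ∷ -[1+ 680 ] ∷ + 548 ∷ -[1+ 320 ] ∷
    + 106 ∷ + 80 ∷ -[1+ 313 ] ∷ + 580 ∷ -[1+ 756 ] ∷ + 828 ∷ -[1+ 893 ] ∷ + 940 ∷ -[1+ 800 ] ∷ + 445 ∷ -[1+ 37 ] ∷ -[1+ 356 ] ∷
    + 854 ∷ -[1+ 1405 ] ∷ + 1715 ∷ -[1+ 1640 ] ∷ + 1378 ∷ -[1+ 1017 ] ∷ + 375 ∷ + 538 ∷ -[1+ 1287 ] ∷ + 1616 ∷ -[1+ 1771 ] ∷ + 1913 ∷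
    -[1+ 1712 ] ∷ + 1048 ∷ -[1+ 433 ] ∷ + 218 ∷ + 31 ∷ -[1+ 665 ] ∷ + 1229 ∷ -[1+ 1365 ] ∷ + 1644 ∷ -[1+ 2477 ] ∷ + 3090 ∷ -[1+ 2689 ] ∷
    + 1789 ∷ -[1+ 1029 ] ∷ -[1+ 250 ] ∷ + 2641 ∷ -[1+ 4915 ] ∷ + 5594 ∷ -[1+ 5176 ] ∷ + 4715 ∷ -[1+ 3374 ] ∷ + 120 ∷ + 3434 ∷ -[1+ 4940 ] ∷
    + 4991 ∷ -[1+ 5412 ] ∷ + 5271 ∷ -[1+ 2715 ] ∷ -[1+ 422 ] ∷ + 818 ∷ + 578 ∷ -[1+ 367 ] ∷ -[1+ 790 ] ∷ -[1+ 102 ] ∷ + 1202 ∷ + 2073 ∷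
    + 1866 ∷ + 877 ∷ + 20 ∷ -[1+ 3 ] ∷ + 709 ∷ + 1421 ∷ + 1448 ∷ + 748 ∷ -[1+ 87 ] ∷ -[1+ 398 ] ∷ -[1+ 24 ] ∷ + 592 ∷
    + 844 ∷ + 493 ∷ -[1+ 151 ] ∷ -[1+ 545 ] ∷ -[1+ 397 ] ∷ + 95 ∷ + 461 ∷ + 378 ∷ -[1+ 54 ] ∷ -[1+ 442 ] ∷ -[1+ 457 ] ∷ -[1+ 119 ] ∷
    + 252 ∷ + 334 ∷ + 82 ∷ -[1+ 256 ] ∷ -[1+ 377 ] ∷ -[1+ 190 ] ∷ + 122 ∷ + 283 ∷ + 170 ∷ -[1+ 94 ] ∷ -[1+ 266 ] ∷ -[1+ 202 ] ∷
    + 26 ∷ + 210 ∷ + 195 ∷ + 12 ∷ -[1+ 165 ] ∷ -[1+ 185 ] ∷ -[1+ 40 ] ∷ + 129 ∷ + 176 ∷ + 70 ∷ -[1+ 85 ] ∷ -[1+ 152 ] ∷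
    -[1+ 79 ] ∷ + 58 ∷ + 136 ∷ + 92 ∷ -[1+ 26 ] ∷ -[1+ 111 ] ∷ -[1+ 91 ] ∷ + 6 ∷ + 92 ∷ + 92 ∷ + 13 ∷ -[1+ 70 ] ∷
    -[1+ 85 ] ∷ -[1+ 25 ] ∷ + 52 ∷ + 79 ∷ + 35 ∷ -[1+ 35 ] ∷ -[1+ 69 ] ∷ -[1+ 40 ] ∷ + 21 ∷ + 59 ∷ + 43 ∷ -[1+ 8 ] ∷
    -[1+ 48 ] ∷ -[1+ 43 ] ∷ -[1+ 0 ] ∷ + 39 ∷ + 42 ∷ + 9 ∷ -[1+ 29 ] ∷ -[1+ 38 ] ∷ -[1+ 13 ] ∷ + 21 ∷ + 36 ∷ + 18 ∷
    -[1+ 13 ] ∷ -[1+ 30 ] ∷ -[1+ 19 ] ∷ + 7 ∷ + 26 ∷ + 21 ∷ -[1+ 1 ] ∷ -[1+ 20 ] ∷ -[1+ 20 ] ∷ -[1+ 1 ] ∷ + 17 ∷ + 20 ∷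
    + 5 ∷ -[1+ 11 ] ∷ -[1+ 17 ] ∷ -[1+ 6 ] ∷ + 9 ∷ + 16 ∷ + 9 ∷ -[1+ 4 ] ∷ -[1+ 13 ] ∷ -[1+ 9 ] ∷ + 2 ∷ + 11 ∷
    + 10 ∷ + 0 ∷ -[1+ 8 ] ∷ -[1+ 9 ] ∷ -[1+ 1 ] ∷ + 7 ∷ + 9 ∷ + 3 ∷ -[1+ 4 ] ∷ -[1+ 7 ] ∷ -[1+ 3 ] ∷ + 3 ∷
    + 7 ∷ + 4 ∷ -[1+ 1 ] ∷ -[1+ 5 ] ∷ -[1+ 4 ] ∷ + 1 ∷ + 5 ∷ + 5 ∷ + 0 ∷ -[1+ 3 ] ∷ -[1+ 3 ] ∷ -[1+ 0 ] ∷
    + 3 ∷ + 4 ∷ + 2 ∷ -[1+ 1 ] ∷ -[1+ 3 ] ∷ -[1+ 1 ] ∷ + 1 ∷ + 3 ∷ + 2 ∷ -[1+ 0 ] ∷ -[1+ 2 ] ∷ -[1+ 1 ] ∷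
    + 0 ∷ + 2 ∷ + 2 ∷ + 0 ∷ -[1+ 1 ] ∷ -[1+ 1 ] ∷ -[1+ 0 ] ∷ + 1 ∷ + 2 ∷ + 1 ∷ -[1+ 0 ] ∷ -[1+ 1 ] ∷
    -[1+ 0 ] ∷ + 0 ∷ + 1 ∷ + 1 ∷ + 0 ∷ -[1+ 0 ] ∷ -[1+ 0 ] ∷ + 0 ∷ + 1 ∷ + 1 ∷ + 0 ∷ -[1+ 0 ] ∷
    -[1+ 0 ] ∷ + 0 ∷ + 0 ∷ + 1 ∷ + 0 ∷ + 0 ∷ -[1+ 0 ] ∷ + 0 ∷ + 0 ∷ + 1 ∷ + 0 ∷ + 0 ∷
    -[1+ 0 ] ∷ []

  g₂ : ℤ
  g₂ = + 8448

  G₂ : Poly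
  G₂ =
    + 7986 ∷ + 7366 ∷ + 6647 ∷ + 5875 ∷ + 5088 ∷ + 4315 ∷ + 3580 ∷ + 2898 ∷ + 2278 ∷ + 1728 ∷ + 1249 ∷ + 840 ∷
    + 499 ∷ + 220 ∷ + 0 ∷ -[1+ 168 ] ∷ -[1+ 292 ] ∷ -[1+ 377 ] ∷ -[1+ 430 ] ∷ -[1+ 456 ] ∷ -[1+ 461 ] ∷ -[1+ 449 ] ∷ -[1+ 425 ] ∷ -[1+ 393 ] ∷
    -[1+ 355 ] ∷ -[1+ 314 ] ∷ -[1+ 272 ] ∷ -[1+ 231 ] ∷ -[1+ 192 ] ∷ -[1+ 155 ] ∷ -[1+ 122 ] ∷ -[1+ 93 ] ∷ -[1+ 67 ] ∷ -[1+ 45 ] ∷ -[1+ 27 ] ∷ -[1+ 12 ] ∷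
    -[1+ 0 ] ∷ + 8 ∷ + 15 ∷ + 20 ∷ + 23 ∷ + 24 ∷ + 25 ∷ + 24 ∷ + 23 ∷ + 21 ∷ + 19 ∷ + 17 ∷
    + 15 ∷ + 12 ∷ + 10 ∷ + 8 ∷ + 7 ∷ + 5 ∷ + 4 ∷ + 3 ∷ + 2 ∷ + 1 ∷ + 0 ∷ + 0 ∷
    -[1+ 0 ] ∷ -[1+ 0 ] ∷ -[1+ 0 ] ∷ -[1+ 0 ] ∷ -[1+ 0 ] ∷ -[1+ 0 ] ∷ -[1+ 0 ] ∷ -[1+ 0 ] ∷ -[1+ 0 ] ∷ -[1+ 0 ] ∷ -[1+ 0 ] ∷ -[1+ 0 ] ∷
    -[1+ 0 ] ∷ + 0 ∷ + 0 ∷ + 0 ∷ + 0 ∷ + 0 ∷ + 0 ∷ + 0 ∷ []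

opaque
  unfolding G₁ g₂ G₂

  G₁p₀-dominance : ∣ coeff (G₁ ⊗ p₀) 120 ∣ ∸ ‖ clearCoeff 120 (G₁ ⊗ p₀) ‖₁ ≡ 9560
  G₁p₀-dominance = refl

  ‖G₁‖₁≡132894 : ‖ G₁ ‖₁ ≡ 132894
  ‖G₁‖₁≡132894 = refl

  ‖drop10[g₂∷G₂]p₀‖₁≡34 : ‖ drop 10 ((g₂ ∷ G₂) ⊗ p₀) ‖₁ ≡ 34
  ‖drop10[g₂∷G₂]p₀‖₁≡34 = refl

  g₂+negativeSum≡3077 : g₂ + negativeSum G₂ ≡ + 3077
  g₂+negativeSum≡3077 = refl

module _ (F q : Poly) (F01 : ∀ n → IsBit (coeff F n)) (F≈p₀q : F ≈ₚ (p₀ ⊗ q)) where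

  ‖q‖∞≤13 : ‖ q ‖∞ ℕ.≤ 13
  ‖q‖∞≤13 = ℕP.≤-pred (ℕP.*-cancelˡ-< 9560 ‖ q ‖∞ 14 (begin-strict
    9560 ℕ.* ‖ q ‖∞
      ≡⟨ cong (ℕ._* ‖ q ‖∞) G₁p₀-dominance ⟨
    (∣ coeff (G₁ ⊗ p₀) 120 ∣ ∸ ‖ clearCoeff 120 (G₁ ⊗ p₀) ‖₁) ℕ.* ‖ q ‖∞
      ≤⟨ dominant-coeff-bound p₀ q F F≈p₀q (∣bit∣≤1 ∘ F01) G₁ 120 ⟩
    ‖ G₁ ‖₁ ℕ.* 1
      ≡⟨ cong (ℕ._* 1) ‖G₁‖₁≡132894 ⟩
    132894 ℕ.* 1
      <⟨ ℕP.≤ᵇ⇒≤ 132895 133840 tt ⟩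
    9560 ℕ.* 14
      ∎))
    where open ℕP.≤-Reasoning

  leading-coeff≡1 : ∀ {d} → HasDegree q d → coeff F (10 ℕ.+ d) ≡ + 1
  leading-coeff≡1 {d} (q_d≢0 , q>d≡0) with F01 (10 ℕ.+ d)
  ... | inj₂ F_N≡1 = F_N≡1
  ... | inj₁ F_N≡0 = ⊥-elim (q_d≢0 (trans (sym F_N≡q_d) F_N≡0))
    where
    F_N≡q_d : coeff F (10 ℕ.+ d) ≡ coeff q d
    F_N≡q_d = trans (F≈p₀q (10 ℕ.+ d))
                (trans (coeff-⊗-drop p₀ q 10 d q>d≡0) (trans (coeff-[a]⊗ (+ 1) q d) (ℤP.*-identityˡ _)))

  ∣top-coeff∣≤442 : ∀ {d} → VanishesAbove d q → ∣ coeff ((g₂ ∷ G₂) ⊗ F) (10 ℕ.+ d) ∣ ℕ.≤ 442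
  ∣top-coeff∣≤442 {d} q>d≡0 = begin
    ∣ coeff ((g₂ ∷ G₂) ⊗ F) (10 ℕ.+ d) ∣        ≡⟨ cong ∣_∣ (coeff-⊗-top p₀ q F F≈p₀q q>d≡0 (g₂ ∷ G₂) 10) ⟩
    ∣ coeff (drop 10 ((g₂ ∷ G₂) ⊗ p₀) ⊗ q) d ∣  ≤⟨ ∣coeff-⊗∣≤ (drop 10 ((g₂ ∷ G₂) ⊗ p₀)) q 13 q≤13 d ⟩
    ‖ drop 10 ((g₂ ∷ G₂) ⊗ p₀) ‖₁ ℕ.* 13        ≡⟨ cong (ℕ._* 13) ‖drop10[g₂∷G₂]p₀‖₁≡34 ⟩
    442                                         ∎
    where
    open ℕP.≤-Reasoning
    q≤13 : ∀ k → ∣ coeff q k ∣ ℕ.≤ 13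
    q≤13 k = ℕP.≤-trans (∣coeff∣≤‖‖∞ q k) ‖q‖∞≤13

  3077≤top-coeff : ∀ {d} → HasDegree q d → + 3077 ℤ.≤ coeff ((g₂ ∷ G₂) ⊗ F) (10 ℕ.+ d)
  3077≤top-coeff {d} q-deg = begin
    + 3077                                 ≡⟨ g₂+negativeSum≡3077 ⟨
    g₂ + negativeSum G₂                    ≤⟨ g+negativeSum≤coeff-⊗ g₂ G₂ F F01 (9 ℕ.+ d) (leading-coeff≡1 q-deg) ⟩
    coeff ((g₂ ∷ G₂) ⊗ F) (10 ℕ.+ d)       ∎
    where open ℤP.≤-Reasoning

  no-degree : ∀ {d} → ¬ HasDegree q d
  no-degree q-deg@(_ , q>d≡0) = ℕP.≤⇒≤ᵇ (ℤP.drop‿+≤+ 3077≤442)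
    where
    i≤+∣i∣ : ∀ i → i ℤ.≤ + ∣ i ∣
    i≤+∣i∣ (+ _)    = ℤP.≤-refl
    i≤+∣i∣ -[1+ _ ] = -≤+
    3077≤442 : + 3077 ℤ.≤ + 442
    3077≤442 = ℤP.≤-trans (3077≤top-coeff q-deg) (ℤP.≤-trans (i≤+∣i∣ _) (+≤+ (∣top-coeff∣≤442 q>d≡0)))

mainTheorem2 : ¬ (Σ Poly λ F → Σ Poly λ q → IsNewman F × (F ≈ₚ (p₀ ⊗ q)))
mainTheorem2 (F , q , (F01 , F₀≡1) , F≈p₀q) with zero⊎degree q
... | inj₂ (d , q-deg) = no-degree F q F01 F≈p₀q q-deg
... | inj₁ q≡0         = 1≢0 (begin
  + 1                     ≡⟨ F₀≡1 ⟨
  coeff F 0               ≡⟨ F≈p₀q 0 ⟩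
  coeff (p₀ ⊗ q) 0        ≡⟨ coeff-∷⊗ (+ 1) (drop 1 p₀) q 0 ⟩
  + 1 * coeff q 0 + + 0   ≡⟨ cong (λ x → + 1 * x + + 0) (q≡0 0) ⟩
  + 0                     ∎)
  where
  open ≡-Reasoning
  1≢0 : + 1 ≢ + 0
  1≢0 ()
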